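{- Let $A$ and $S$ be finite sets, let $f:A\to A$ be a map, and let $\varphi:A\to S$ be a surjective map. Then $f$ is a bijection if and only if the following two conditions hold: (i) $f$ is injective on $\varphi^{ -1}(s)$ for every $s\in S$; (ii) for each bijection $h:S\to S$ there exists a uniquely determined surjective map $\psi:A\to S$ such that $\psi\circ f=h\circ\varphi$. -}

module Defs where

open import Data.Fin using (Fin)
open import Data.Product using (Σ; _×_)
open import Relation.Binary.PropositionalEquality using (_≡_; _≗_)
open import Function using (_∘_)
open import Function.Definitions using (Surjective; Bijective)

InjectiveOnFibres : {A S : Set} → (A → A) → (A → S) → Set
InjectiveOnFibres {A} {S} f φ =
  ∀ (s : S) (x y : A) → φ x ≡ s → φ y ≡ s → f x ≡ f y → x ≡ y

-- for each bijection h : S → S there is a unique surjective ψ : A → S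
-- with ψ ∘ f = h ∘ φ (map equality read pointwise, as Agda lacks funext)
UniqueLift : {A S : Set} → (A → A) → (A → S) → Set
UniqueLift {A} {S} f φ =
  ∀ (h : S → S) → Bijective _≡_ _≡_ h →
    Σ (A → S) λ ψ →
      (Surjective _≡_ _≡_ ψ × (ψ ∘ f ≗ h ∘ φ))
      × (∀ (ψ′ : A → S) → Surjective _≡_ _≡_ ψ′ → ψ′ ∘ f ≗ h ∘ φ → ψ′ ≗ ψ)

{-# OPTIONS --safe #-}
module Submission where

open import Defs
open import Data.Nat using (ℕ; zero; suc)
open import Data.Nat.Properties using (1+n≰n)
open import Data.Fin using (Fin; punchOut)
open import Data.Fin.Properties using (any?; _≟_; injective⇒≤; punchOut-injective)
open import Data.Product using (Σ; _×_; _,_; proj₁; proj₂)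
open import Relation.Binary.PropositionalEquality
open import Relation.Nullary using (yes; no)
open import Relation.Nullary.Negation using (contradiction)
open import Function using (_∘_; id)
open import Function.Bundles using (_⇔_; mk⇔)
open import Function.Definitions using (Injective; Surjective; Bijective)
import Function.Construct.Identity as Identity
import Function.Construct.Composition as Composition

-- For bijective f the lift of h is h ∘ φ ∘ f⁻¹; it is surjective because
-- h ∘ φ is, and unique because f is surjective.  Conversely, the lift ψ of
-- the identity of S satisfies ψ ∘ f ≗ φ, so f x ≡ f y forces φ x ≡ φ y and
-- fibrewise injectivity makes f injective; an injective self-map of a
-- finite set is bijective.

injective⇒surjective : ∀ {n} {f : Fin n → Fin n} →
                       Injective _≡_ _≡_ f → Surjective _≡_ _≡_ f
injective⇒surjective {zero}  _ ()
injective⇒surjective {suc n} {f} f-inj y with any? (λ x → f x ≟ y)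
... | yes (x , fx≡y) = x , λ { refl → fx≡y }
... | no y∉image = contradiction (injective⇒≤ f-punched-inj) 1+n≰n
  where
  -- A missed y lets f be punched out to an injection Fin (suc n) → Fin n.
  y≢f : ∀ x → y ≢ f x
  y≢f x y≡fx = y∉image (x , sym y≡fx)

  f-punched-inj : Injective _≡_ _≡_ (λ x → punchOut (y≢f x))
  f-punched-inj = f-inj ∘ punchOut-injective (y≢f _) (y≢f _)

module _ {A B C : Set} {f : A → B} where

  lift-along-bijection : (g : A → C) → Bijective _≡_ _≡_ f →
                         Σ (B → C) λ ψ → ψ ∘ f ≗ g
  lift-along-bijection g (f-inj , f-surj) = g ∘ f⁻¹ , λ x → cong g (f⁻¹∘f x)
    where
    f⁻¹ : B → A
    f⁻¹ y = proj₁ (f-surj y)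

    f⁻¹∘f : ∀ x → f⁻¹ (f x) ≡ x
    f⁻¹∘f x = f-inj (proj₂ (f-surj (f x)) refl)

  lift-surjective : {g : A → C} {ψ : B → C} → ψ ∘ f ≗ g →
                    Surjective _≡_ _≡_ g → Surjective _≡_ _≡_ ψ
  lift-surjective ψ∘f≗g g-surj z =
    f x , λ { refl → trans (ψ∘f≗g x) (proj₂ (g-surj z) refl) }
    where
    x : A
    x = proj₁ (g-surj z)

  lift-unique : {g : A → C} {ψ ψ′ : B → C} → Surjective _≡_ _≡_ f →
                ψ ∘ f ≗ g → ψ′ ∘ f ≗ g → ψ′ ≗ ψ
  lift-unique {ψ = ψ} {ψ′} f-surj ψ∘f≗g ψ′∘f≗g y = begin
    ψ′ y      ≡⟨ cong ψ′ (sym f[x]≡y) ⟩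
    ψ′ (f x)  ≡⟨ trans (ψ′∘f≗g x) (sym (ψ∘f≗g x)) ⟩
    ψ (f x)   ≡⟨ cong ψ f[x]≡y ⟩
    ψ y       ∎
    where
    open ≡-Reasoning
    x : A
    x = proj₁ (f-surj y)

    f[x]≡y : f x ≡ y
    f[x]≡y = proj₂ (f-surj y) refl

  factorisation⇒kernel⊆ : {g : A → C} {ψ : B → C} → ψ ∘ f ≗ g →
                          ∀ {x y} → f x ≡ f y → g x ≡ g y
  factorisation⇒kernel⊆ {ψ = ψ} ψ∘f≗g {x} {y} fx≡fy =
    trans (sym (ψ∘f≗g x)) (trans (cong ψ fx≡fy) (ψ∘f≗g y))

module _ {A S : Set} {f : A → A} {φ : A → S} where

  injective⇒injectiveOnFibres : Injective _≡_ _≡_ f → InjectiveOnFibres f φ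
  injective⇒injectiveOnFibres f-inj _ _ _ _ _ = f-inj

  bijective⇒uniqueLift : Surjective _≡_ _≡_ φ → Bijective _≡_ _≡_ f →
                         UniqueLift f φ
  bijective⇒uniqueLift φ-surj f-bij h (_ , h-surj) =
    ψ , (lift-surjective ψ∘f≗h∘φ h∘φ-surj , ψ∘f≗h∘φ) ,
    λ ψ′ _ ψ′∘f≗h∘φ → lift-unique (proj₂ f-bij) ψ∘f≗h∘φ ψ′∘f≗h∘φ
    where
    h∘φ-surj : Surjective _≡_ _≡_ (h ∘ φ)
    h∘φ-surj = Composition.surjective _≡_ _≡_ _≡_ φ-surj h-surj
    ψ : A → S
    ψ = proj₁ (lift-along-bijection (h ∘ φ) f-bij)

    ψ∘f≗h∘φ : ψ ∘ f ≗ h ∘ φ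
    ψ∘f≗h∘φ = proj₂ (lift-along-bijection (h ∘ φ) f-bij)

  injectiveOnFibres∧uniqueLift⇒injective : InjectiveOnFibres f φ →
                                           UniqueLift f φ →
                                           Injective _≡_ _≡_ f
  injectiveOnFibres∧uniqueLift⇒injective fibre-inj unique-lift {x} {y} fx≡fy =
    fibre-inj (φ y) x y (factorisation⇒kernel⊆ {ψ = ψ} ψ∘f≗φ fx≡fy) refl fx≡fy
    where
    ψ : A → S
    ψ = proj₁ (unique-lift id (Identity.bijective _≡_))

    ψ∘f≗φ : ψ ∘ f ≗ φ
    ψ∘f≗φ = proj₂ (proj₁ (proj₂ (unique-lift id (Identity.bijective _≡_))))

theorem3p1 : (n m : ℕ) (f : Fin n → Fin n) (φ : Fin n → Fin m) → Surjective _≡_ _≡_ φ → (Bijective _≡_ _≡_ f ⇔ (InjectiveOnFibres f φ × UniqueLift f φ))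
theorem3p1 n m f φ φ-surj = mk⇔
  (λ f-bij@(f-inj , _) → injective⇒injectiveOnFibres f-inj ,
                         bijective⇒uniqueLift φ-surj f-bij)
  (λ (fibre-inj , unique-lift) →
     let f-inj = injectiveOnFibres∧uniqueLift⇒injective fibre-inj unique-lift
     in f-inj , injective⇒surjective f-inj)
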